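{- Let $G=(V,E)$ be a finite simple undirected graph with set of open wedges $\mathcal W$. Consider the binary program (P): minimize $\sum_{(i,j)\in E}\bigl(\tfrac12 y_{ij}+\tfrac12(1-z_{ij})\bigr)$ subject to $z_{ik}\le y_{jk}$ and $z_{jk}\le y_{ik}$ for every open wedge $(i,j,k)\in\mathcal W$ (centered at $k$), and $y_{ij},z_{ij}\in\{0,1\}$ for all $(i,j)\in E$. If $\{y_{ij},z_{ij}\}_{(i,j)\in E}$ is feasible for (P), then $x_{ij}=\tfrac12(y_{ij}-z_{ij}+1)$ for $(i,j)\in E$ defines a feasible half-integral solution of the STC LP with the same objective value. Conversely, if $\{x_{ij}\}_{(i,j)\in E}$ is a feasible half-integral solution of the STC LP, then setting $(y_{ij},z_{ij})=(0,1)$ if $x_{ij}=0$, $(1,1)$ if $x_{ij}=1/2$, and $(1,0)$ if $x_{ij}=1$, for all $(i,j)\in E$, gives a feasible solution of (P) with the same objective value.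
   Context: An open wedge centered at $k$ is a triple $(i,j,k)$ of distinct nodes with $(i,k),(j,k)\in E$ and $(i,j)\notin E$. The STC LP is: minimize $\sum_{(i,j)\in E}x_{ij}$ subject to $x_{ik}+x_{jk}\ge1$ for all $(i,j,k)\in\mathcal W$ and $x_{ij}\ge0$ for all $(i,j)\in E$. A solution is half-integral if $x_{ij}\in\{0,1/2,1\}$ for all $(i,j)\in E$. -}

module Defs where

open import Data.Nat using (ℕ; _<ᵇ_)
open import Data.Fin using (Fin; toℕ)
open import Data.Bool using (Bool; true; false; _∧_; if_then_else_)
open import Data.List using (List; foldr; map; concatMap; allFin)
open import Data.Product using (_×_; _,_)
open import Data.Sum using (_⊎_)
open import Data.Rational using (ℚ; 0ℚ; 1ℚ; ½; _+_; _-_; _*_; _≤_)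
open import Relation.Binary.PropositionalEquality using (_≡_; _≢_)
open import Relation.Nullary using (¬_)

record Graph (n : ℕ) : Set where
  field
    adj    : Fin n → Fin n → Bool
    sym    : ∀ i j → adj i j ≡ adj j i
    irrefl : ∀ i → adj i i ≡ false
open Graph public

module _ {n : ℕ} (G : Graph n) where

  Edge : Fin n → Fin n → Set
  Edge i j = adj G i j ≡ true

  OpenWedge : Fin n → Fin n → Fin n → Set
  OpenWedge i j k = i ≢ j × i ≢ k × j ≢ k × Edge i k × Edge j k × ¬ Edge i j

  -- A family of rational variables indexed by edges is represented as a
  -- function on ordered pairs that is symmetric on edges (values on
  -- non-edges are irrelevant).
  SymOnEdges : (Fin n → Fin n → ℚ) → Set
  SymOnEdges x = ∀ i j → Edge i j → x i j ≡ x j i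

  edgeSum : (Fin n → Fin n → ℚ) → ℚ
  edgeSum f = foldr _+_ 0ℚ
    (concatMap (λ i → map (λ j →
       if adj G i j ∧ (toℕ i <ᵇ toℕ j) then f i j else 0ℚ) (allFin n)) (allFin n))

  STCFeasible : (Fin n → Fin n → ℚ) → Set
  STCFeasible x =
    SymOnEdges x ×
    (∀ i j → Edge i j → 0ℚ ≤ x i j) ×
    (∀ i j k → OpenWedge i j k → 1ℚ ≤ x i k + x j k)

  HalfIntegral : (Fin n → Fin n → ℚ) → Set
  HalfIntegral x = ∀ i j → Edge i j → x i j ≡ 0ℚ ⊎ x i j ≡ ½ ⊎ x i j ≡ 1ℚ

  objLP : (Fin n → Fin n → ℚ) → ℚ
  objLP x = edgeSum x

  Binary : (Fin n → Fin n → ℚ) → Set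
  Binary y = ∀ i j → Edge i j → y i j ≡ 0ℚ ⊎ y i j ≡ 1ℚ

  PFeasible : (Fin n → Fin n → ℚ) → (Fin n → Fin n → ℚ) → Set
  PFeasible y z =
    SymOnEdges y × SymOnEdges z × Binary y × Binary z ×
    (∀ i j k → OpenWedge i j k → z i k ≤ y j k × z j k ≤ y i k)

  objP : (Fin n → Fin n → ℚ) → (Fin n → Fin n → ℚ) → ℚ
  objP y z = edgeSum (λ i j → ½ * y i j + ½ * (1ℚ - z i j))

{-# OPTIONS --safe #-}
-- The map x = ½ (y − z + 1) is monotone in y, antitone in z, and x(a,b) + x(b,a) = 1.
-- On a wedge (i,j,k) the constraints of (P) say z_ik ≤ y_jk and z_jk ≤ y_ik, so lowering
-- y_ik to z_jk and y_jk to z_ik shows x_ik + x_jk ≥ 1. Conversely y = [x ≠ 0] and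
-- z = [x ≠ 1], and z_ik ≤ y_jk can only fail when x_jk = 0 and x_ik < 1, which the
-- wedge constraint x_ik + x_jk ≥ 1 rules out for half-integral x. Both objectives agree
-- termwise because ½ (y − z + 1) = ½ y + ½ (1 − z).
module Submission where

open import Defs hiding (sym)
open import Data.Nat using (ℕ; _<ᵇ_)
open import Data.Fin using (Fin; toℕ)
open import Data.Bool using (true; false; _∧_; if_then_else_)
open import Data.List using (foldr; allFin)
open import Data.List.Properties using (map-cong; concatMap-cong)
open import Data.Product using (_×_; _,_; ∃-syntax)
open import Data.Sum using (_⊎_; inj₁; inj₂)
open import Data.Rational using (ℚ; 0ℚ; 1ℚ; ½; _+_; _-_; _*_; _≤_)
open import Data.Rational.Properties
  using (_≟_; _≤?_; ≤-refl; ≤-reflexive; +-comm; +-identityʳ; +-mono-≤; +-monoˡ-≤;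
         neg-antimono-≤; *-monoˡ-≤-nonNeg; module ≤-Reasoning)
open import Data.Rational.Solver using (module +-*-Solver)
open import Relation.Binary.PropositionalEquality using (_≡_; refl; sym; trans; cong; cong₂; subst)
open import Relation.Nullary using (yes; no; contradiction)
open import Relation.Nullary.Decidable using (⌊_⌋; from-yes; from-no)

IsBit : ℚ → Set
IsBit a = a ≡ 0ℚ ⊎ a ≡ 1ℚ

IsHalfIntegral : ℚ → Set
IsHalfIntegral a = a ≡ 0ℚ ⊎ a ≡ ½ ⊎ a ≡ 1ℚ

bit⇒0≤ : ∀ {a} → IsBit a → 0ℚ ≤ a
bit⇒0≤ (inj₁ refl) = ≤-refl
bit⇒0≤ (inj₂ refl) = from-yes (0ℚ ≤? 1ℚ)

bit⇒≤1 : ∀ {a} → IsBit a → a ≤ 1ℚ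
bit⇒≤1 (inj₁ refl) = from-yes (0ℚ ≤? 1ℚ)
bit⇒≤1 (inj₂ refl) = ≤-refl

halfIntegral∧1≤⇒≡1 : ∀ {a} → IsHalfIntegral a → 1ℚ ≤ a → a ≡ 1ℚ
halfIntegral∧1≤⇒≡1 (inj₁ refl)        1≤0 = contradiction 1≤0 (from-no (1ℚ ≤? 0ℚ))
halfIntegral∧1≤⇒≡1 (inj₂ (inj₁ refl)) 1≤½ = contradiction 1≤½ (from-no (1ℚ ≤? ½))
halfIntegral∧1≤⇒≡1 (inj₂ (inj₂ refl)) _   = refl

toX : ℚ → ℚ → ℚ
toX a b = ½ * (a - b + 1ℚ)

toX-mono-≤ : ∀ {a a′ b b′} → a ≤ a′ → b′ ≤ b → toX a b ≤ toX a′ b′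
toX-mono-≤ a≤a′ b′≤b =
  *-monoˡ-≤-nonNeg ½ (+-monoˡ-≤ 1ℚ (+-mono-≤ a≤a′ (neg-antimono-≤ b′≤b)))

toX+toX-flip≡1 : ∀ a b → toX a b + toX b a ≡ 1ℚ
toX+toX-flip≡1 = solve 2
  (λ a b → con ½ :* (a :- b :+ con 1ℚ) :+ con ½ :* (b :- a :+ con 1ℚ) := con 1ℚ) refl
  where open +-*-Solver

toX≡objective : ∀ a b → toX a b ≡ ½ * a + ½ * (1ℚ - b)
toX≡objective = solve 2
  (λ a b → con ½ :* (a :- b :+ con 1ℚ) := con ½ :* a :+ con ½ :* (con 1ℚ :- b)) refl
  where open +-*-Solver

toX-nonNeg : ∀ {a b} → 0ℚ ≤ a → b ≤ 1ℚ → 0ℚ ≤ toX a b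
toX-nonNeg 0≤a b≤1 = toX-mono-≤ 0≤a b≤1

toX-wedge : ∀ {a b c d} → b ≤ c → d ≤ a → 1ℚ ≤ toX a b + toX c d
toX-wedge {a} {b} {c} {d} b≤c d≤a = begin
  1ℚ                ≡⟨ sym (toX+toX-flip≡1 d b) ⟩
  toX d b + toX b d ≤⟨ +-mono-≤ (toX-mono-≤ d≤a ≤-refl) (toX-mono-≤ b≤c ≤-refl) ⟩
  toX a b + toX c d ∎
  where open ≤-Reasoning

toX-halfIntegral : ∀ {a b} → IsBit a → IsBit b → IsHalfIntegral (toX a b)
toX-halfIntegral (inj₁ refl) (inj₁ refl) = inj₂ (inj₁ refl)
toX-halfIntegral (inj₁ refl) (inj₂ refl) = inj₁ refl
toX-halfIntegral (inj₂ refl) (inj₁ refl) = inj₂ (inj₂ refl)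
toX-halfIntegral (inj₂ refl) (inj₂ refl) = inj₂ (inj₁ refl)

toY : ℚ → ℚ
toY a = if ⌊ a ≟ 0ℚ ⌋ then 0ℚ else 1ℚ

toZ : ℚ → ℚ
toZ a = if ⌊ a ≟ 1ℚ ⌋ then 0ℚ else 1ℚ

toY-bit : ∀ a → IsBit (toY a)
toY-bit a with ⌊ a ≟ 0ℚ ⌋
... | true  = inj₁ refl
... | false = inj₂ refl

toZ-bit : ∀ a → IsBit (toZ a)
toZ-bit a with ⌊ a ≟ 1ℚ ⌋
... | true  = inj₁ refl
... | false = inj₂ refl

toY-toZ-table : ∀ a →
  (a ≡ 0ℚ → toY a ≡ 0ℚ × toZ a ≡ 1ℚ) ×
  (a ≡ ½  → toY a ≡ 1ℚ × toZ a ≡ 1ℚ) ×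
  (a ≡ 1ℚ → toY a ≡ 1ℚ × toZ a ≡ 0ℚ)
toY-toZ-table a = (λ { refl → refl , refl }) , (λ { refl → refl , refl }) , (λ { refl → refl , refl })

toX-toY-toZ : ∀ {a} → IsHalfIntegral a → toX (toY a) (toZ a) ≡ a
toX-toY-toZ (inj₁ refl)        = refl
toX-toY-toZ (inj₂ (inj₁ refl)) = refl
toX-toY-toZ (inj₂ (inj₂ refl)) = refl

toZ≤toY : ∀ {a} b → IsHalfIntegral a → 1ℚ ≤ a + b → toZ a ≤ toY b
toZ≤toY {a} b ha 1≤a+b with b ≟ 0ℚ
... | no _     = bit⇒≤1 (toZ-bit a)
... | yes refl = ≤-reflexive (cong toZ (halfIntegral∧1≤⇒≡1 ha 1≤a))
  where 1≤a = subst (1ℚ ≤_) (+-identityʳ a) 1≤a+b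

module _ {n : ℕ} (G : Graph n) where

  edgeSum-cong : ∀ {f g : Fin n → Fin n → ℚ} →
                 (∀ i j → Edge G i j → f i j ≡ g i j) → edgeSum G f ≡ edgeSum G g
  edgeSum-cong {f} {g} f≡g =
    cong (foldr _+_ 0ℚ) (concatMap-cong (λ i → map-cong (summand≡ i) (allFin n)) (allFin n))
    where
    summand≡ : ∀ i j → (if adj G i j ∧ (toℕ i <ᵇ toℕ j) then f i j else 0ℚ)
                     ≡ (if adj G i j ∧ (toℕ i <ᵇ toℕ j) then g i j else 0ℚ)
    summand≡ i j with adj G i j in ij∈E
    ... | true  = cong (λ v → if toℕ i <ᵇ toℕ j then v else 0ℚ) (f≡g i j ij∈E)
    ... | false = refl

  PFeasible⇒STCFeasible : ∀ {y z} → PFeasible G y z → STCFeasible G (λ i j → toX (y i j) (z i j))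
  PFeasible⇒STCFeasible (sym-y , sym-z , bit-y , bit-z , wedge) =
    (λ i j ij → cong₂ toX (sym-y i j ij) (sym-z i j ij)) ,
    (λ i j ij → toX-nonNeg (bit⇒0≤ (bit-y i j ij)) (bit⇒≤1 (bit-z i j ij))) ,
    (λ i j k w → let zik≤yjk , zjk≤yik = wedge i j k w in toX-wedge zik≤yjk zjk≤yik)

  PFeasible⇒HalfIntegral : ∀ {y z} → PFeasible G y z → HalfIntegral G (λ i j → toX (y i j) (z i j))
  PFeasible⇒HalfIntegral (_ , _ , bit-y , bit-z , _) i j ij = toX-halfIntegral (bit-y i j ij) (bit-z i j ij)

  objLP-toX≡objP : ∀ y z → objLP G (λ i j → toX (y i j) (z i j)) ≡ objP G y z
  objLP-toX≡objP y z = edgeSum-cong (λ i j _ → toX≡objective (y i j) (z i j))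

  STCFeasible⇒PFeasible : ∀ {x} → STCFeasible G x → HalfIntegral G x →
                          PFeasible G (λ i j → toY (x i j)) (λ i j → toZ (x i j))
  STCFeasible⇒PFeasible {x} (sym-x , _ , cover) half =
    (λ i j ij → cong toY (sym-x i j ij)) ,
    (λ i j ij → cong toZ (sym-x i j ij)) ,
    (λ i j _ → toY-bit (x i j)) ,
    (λ i j _ → toZ-bit (x i j)) ,
    λ { i j k w@(_ , _ , _ , ik , jk , _) →
          toZ≤toY (x j k) (half i k ik) (cover i j k w) ,
          toZ≤toY (x i k) (half j k jk) (subst (1ℚ ≤_) (+-comm (x i k) (x j k)) (cover i j k w)) }

  objP-toY-toZ≡objLP : ∀ {x} → HalfIntegral G x →
                       objP G (λ i j → toY (x i j)) (λ i j → toZ (x i j)) ≡ objLP G x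
  objP-toY-toZ≡objLP {x} half = edgeSum-cong λ i j ij →
    trans (sym (toX≡objective (toY (x i j)) (toZ (x i j)))) (toX-toY-toZ (half i j ij))

lemma3 : ∀ (n : ℕ) (G : Graph n) →
    (∀ (y z : Fin n → Fin n → ℚ) → PFeasible G y z →
      STCFeasible G (λ i j → ½ * (y i j - z i j + 1ℚ)) ×
      HalfIntegral G (λ i j → ½ * (y i j - z i j + 1ℚ)) ×
      objLP G (λ i j → ½ * (y i j - z i j + 1ℚ)) ≡ objP G y z)
    ×
    (∀ (x : Fin n → Fin n → ℚ) → STCFeasible G x → HalfIntegral G x →
      ∃[ y ] ∃[ z ]
        ((∀ i j → Edge G i j →
            (x i j ≡ 0ℚ → y i j ≡ 0ℚ × z i j ≡ 1ℚ) ×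
            (x i j ≡ ½ → y i j ≡ 1ℚ × z i j ≡ 1ℚ) ×
            (x i j ≡ 1ℚ → y i j ≡ 1ℚ × z i j ≡ 0ℚ)) ×
         PFeasible G y z ×
         objP G y z ≡ objLP G x))
lemma3 n G =
  (λ y z feasible →
     PFeasible⇒STCFeasible G feasible ,
     PFeasible⇒HalfIntegral G feasible ,
     objLP-toX≡objP G y z) ,
  (λ x feasible half →
     (λ i j → toY (x i j)) , (λ i j → toZ (x i j)) ,
     (λ i j _ → toY-toZ-table (x i j)) ,
     STCFeasible⇒PFeasible G feasible half ,
     objP-toY-toZ≡objLP G half)
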